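{- For every integer $n\geq 1$, the sum of all $2^{n-1}$ elements of the $n$th generation of the Calkin--Wilf tree equals $$\Sigma(n)=\sum_{j=1}^{2^{n-1}}x_j^{(n)}=3\cdot 2^{n-2}-\frac12 .$$
   Context: The Calkin--Wilf tree is the infinite rooted binary tree whose vertices are labelled by positive rationals, generated from the root $\frac11$ by giving each vertex labelled $\frac ab$ (reduced fraction) a left child $\frac{a}{a+b}$ and a right child $\frac{a+b}{b}$. The $n$th generation is the set of $2^{n-1}$ vertices at distance $n-1$ from the root (the root is generation $1$); its labels, read from left to right, are denoted $x_1^{(n)},\dots,x_{2^{n-1}}^{(n)}$. -}

module Defs where

open import Data.Nat using (ℕ; zero; suc; _+_)
open import Data.Integer using (+_)
open import Data.Rational using (ℚ; _/_) renaming (_+_ to _+ℚ_)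
open import Data.List using (List; []; _∷_; _++_; concatMap; foldr)
open import Data.Product using (_×_; _,_)

-- A Calkin–Wilf vertex label a/b with a, b ≥ 1, stored as the pair of
-- predecessors (a - 1 , b - 1) so that positivity is built in.
Label : Set
Label = ℕ × ℕ

num den : Label → ℕ
num (a , b) = suc a
den (a , b) = suc b

value : Label → ℚ
value (a , b) = + suc a / suc b

-- left child a/(a+b), right child (a+b)/b
leftChild rightChild : Label → Label
leftChild  (a , b) = (a , a + suc b)
rightChild (a , b) = (a + suc b , b)

root : Label
root = (0 , 0)

-- generation n (root is generation 1), listed from left to right;
-- generation 0 is a dummy (unused) value.
generation : ℕ → List Label
generation zero          = []
generation (suc zero)    = root ∷ []
generation (suc (suc n)) = concatMap (λ x → leftChild x ∷ rightChild x ∷ []) (generation (suc n))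

Σgen : ℕ → ℚ
Σgen n = foldr (λ x s → value x +ℚ s) (+ 0 / 1) (generation n)

{-# OPTIONS --safe #-}
-- The right child a/b + 1 of a/b contributes the previous generation plus
-- one per vertex, i.e. Σ(n) + 2^(n-1).  The left children a/(a+b) come in
-- pairs a/(a+b), b/(a+b) summing to 1, because each generation is closed
-- under a/b ↦ b/a; so they contribute 2^(n-2).  Hence
-- Σ(n+1) = Σ(n) + 3·2^(n-2), which telescopes to the closed form.
module Submission where

open import Defs
open import Data.Nat using (ℕ; suc; _^_)
open import Data.Integer using (+_)
open import Data.Rational using (ℚ; _/_; _*_; _-_; ½)
open import Relation.Binary.PropositionalEquality using (_≡_)

open import Algebra.Bundles using (CommutativeMonoid)
open import Data.Integer using (ℤ) renaming (_+_ to _+ℤ_)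
open import Data.Integer.Properties using (*-comm)
import Data.Integer.Solver as ℤ-Solver
open import Data.List using (List; []; _∷_; concatMap; foldr)
open import Data.Nat using (zero) renaming (_+_ to _+ℕ_)
import Data.Nat.Properties as ℕ
open import Data.Product using (_,_; swap)
open import Data.Rational using (_+_; 0ℚ; 1ℚ; toℚᵘ)
open import Data.Rational.Properties
  using (toℚᵘ-injective; toℚᵘ-fromℚᵘ; toℚᵘ-homo-+; +-comm; +-assoc; +-0-commutativeMonoid)
import Data.Rational.Solver as ℚ-Solver
open import Data.Rational.Unnormalised using (mkℚᵘ; *≡*) renaming (_+_ to _+ᵘ_)
import Data.Rational.Unnormalised.Properties as ℚᵘ
open import Function using (_∘_; const)
open import Relation.Binary.PropositionalEquality using (refl; sym; trans; cong; cong₂; module ≡-Reasoning)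

open import Algebra.Properties.CommutativeSemigroup
  (CommutativeMonoid.commutativeSemigroup +-0-commutativeMonoid) using (interchange)

/-+-/ : ∀ (p q : ℤ) n → p / suc n + q / suc n ≡ (p +ℤ q) / suc n
/-+-/ p q n = toℚᵘ-injective (begin
  toℚᵘ (p / suc n + q / suc n)           ≈⟨ toℚᵘ-homo-+ (p / suc n) (q / suc n) ⟩
  toℚᵘ (p / suc n) +ᵘ toℚᵘ (q / suc n)   ≈⟨ ℚᵘ.+-cong (toℚᵘ-fromℚᵘ (mkℚᵘ p n)) (toℚᵘ-fromℚᵘ (mkℚᵘ q n)) ⟩
  mkℚᵘ p n +ᵘ mkℚᵘ q n                   ≈⟨ *≡* (solve 3 (λ p q d → (p :* d :+ q :* d) :* d := (p :+ q) :* (d :* d))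
                                                         refl p q (+ suc n)) ⟩
  mkℚᵘ (p +ℤ q) n                        ≈⟨ ℚᵘ.≃-sym (toℚᵘ-fromℚᵘ (mkℚᵘ (p +ℤ q) n)) ⟩
  toℚᵘ ((p +ℤ q) / suc n)                ∎)
  where
  open ℚᵘ.≃-Reasoning
  open ℤ-Solver.+-*-Solver

n/n≡1 : ∀ n → + suc n / suc n ≡ 1ℚ
n/n≡1 n = toℚᵘ-injective (ℚᵘ.≃-trans (toℚᵘ-fromℚᵘ (mkℚᵘ (+ suc n) n)) (*≡* (*-comm (+ suc n) (+ 1))))

m+1+n≡n+1+m : ∀ m n → m +ℕ suc n ≡ n +ℕ suc m
m+1+n≡n+1+m m n = trans (ℕ.+-comm m (suc n)) (sym (ℕ.+-suc n m))

value-rightChild : ∀ x → value (rightChild x) ≡ value x + 1ℚ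
value-rightChild (a , b) = sym (begin
  + suc a / suc b + 1ℚ                ≡⟨ cong (_+_ (value (a , b))) (sym (n/n≡1 b)) ⟩
  + suc a / suc b + + suc b / suc b   ≡⟨ /-+-/ (+ suc a) (+ suc b) b ⟩
  + (suc a +ℕ suc b) / suc b          ∎)
  where open ≡-Reasoning

value-leftChild-+-swap : ∀ x → value (leftChild x) + value (leftChild (swap x)) ≡ 1ℚ
value-leftChild-+-swap (a , b) = begin
  + suc a / suc (a +ℕ suc b) + + suc b / suc (b +ℕ suc a)
    ≡⟨ cong (λ d → + suc a / suc (a +ℕ suc b) + + suc b / suc d) (m+1+n≡n+1+m b a) ⟩
  + suc a / suc (a +ℕ suc b) + + suc b / suc (a +ℕ suc b)
    ≡⟨ /-+-/ (+ suc a) (+ suc b) (a +ℕ suc b) ⟩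
  + (suc a +ℕ suc b) / suc (a +ℕ suc b)
    ≡⟨ n/n≡1 (a +ℕ suc b) ⟩
  1ℚ ∎
  where open ≡-Reasoning

swap-leftChild : ∀ x → swap (leftChild x) ≡ rightChild (swap x)
swap-leftChild (a , b) = cong (_, a) (m+1+n≡n+1+m a b)

swap-rightChild : ∀ x → swap (rightChild x) ≡ leftChild (swap x)
swap-rightChild (a , b) = cong (b ,_) (m+1+n≡n+1+m a b)

sumBy : {A : Set} → (A → ℚ) → List A → ℚ
sumBy f = foldr (λ x s → f x + s) 0ℚ

module _ {A : Set} where

  sumBy-cong : ∀ {f g : A → ℚ} → (∀ x → f x ≡ g x) → ∀ xs → sumBy f xs ≡ sumBy g xs
  sumBy-cong f≗g []       = refl
  sumBy-cong f≗g (x ∷ xs) = cong₂ _+_ (f≗g x) (sumBy-cong f≗g xs)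

  sumBy-+ : ∀ (f g : A → ℚ) xs → sumBy (λ x → f x + g x) xs ≡ sumBy f xs + sumBy g xs
  sumBy-+ f g []       = refl
  sumBy-+ f g (x ∷ xs) =
    trans (cong (_+_ (f x + g x)) (sumBy-+ f g xs)) (interchange (f x) (g x) (sumBy f xs) (sumBy g xs))

  sumBy-concatMap-pair : ∀ {B : Set} (f : B → ℚ) (g h : A → B) xs →
    sumBy f (concatMap (λ x → g x ∷ h x ∷ []) xs) ≡ sumBy (λ x → f (g x) + f (h x)) xs
  sumBy-concatMap-pair f g h []       = refl
  sumBy-concatMap-pair f g h (x ∷ xs) =
    trans (cong (λ s → f (g x) + (f (h x) + s)) (sumBy-concatMap-pair f g h xs))
          (sym (+-assoc (f (g x)) (f (h x)) _))

+-double-injective : ∀ p q → p + p ≡ q + q → p ≡ q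
+-double-injective p q p+p≡q+q = begin
  p             ≡⟨ halve p ⟩
  (p + p) * ½   ≡⟨ cong (_* ½) p+p≡q+q ⟩
  (q + q) * ½   ≡⟨ sym (halve q) ⟩
  q             ∎
  where
  open ≡-Reasoning
  open ℚ-Solver.+-*-Solver
  halve : ∀ r → r ≡ (r + r) * ½
  halve = solve 1 (λ r → r := (r :+ r) :* con ½) refl

sumBy-swap-generation : ∀ m (f : Label → ℚ) →
  sumBy (f ∘ swap) (generation (suc m)) ≡ sumBy f (generation (suc m))
sumBy-swap-generation zero    f = refl
sumBy-swap-generation (suc m) f = begin
  sumBy (f ∘ swap) (concatMap children G)               ≡⟨ sumBy-concatMap-pair (f ∘ swap) leftChild rightChild G ⟩
  sumBy (λ x → f (swap (leftChild x)) + f (swap (rightChild x))) G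
    ≡⟨ sumBy-cong swapped-children G ⟩
  sumBy (childSum ∘ swap) G                             ≡⟨ sumBy-swap-generation m childSum ⟩
  sumBy childSum G                                      ≡⟨ sym (sumBy-concatMap-pair f leftChild rightChild G) ⟩
  sumBy f (concatMap children G)                        ∎
  where
  open ≡-Reasoning
  G : List Label
  G = generation (suc m)
  children : Label → List Label
  children x = leftChild x ∷ rightChild x ∷ []
  childSum : Label → ℚ
  childSum y = f (leftChild y) + f (rightChild y)
  swapped-children : ∀ x → f (swap (leftChild x)) + f (swap (rightChild x)) ≡ childSum (swap x)
  swapped-children x = trans (cong₂ (λ u v → f u + f v) (swap-leftChild x) (swap-rightChild x))
                             (+-comm (f (rightChild (swap x))) (f (leftChild (swap x))))

-- pow2/2 m is the paper's 2^(n-2) for n = m + 1.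
pow2/2 : ℕ → ℚ
pow2/2 m = + (2 ^ m) / 2

pow2/2-suc : ∀ m → pow2/2 (suc m) ≡ pow2/2 m + pow2/2 m
pow2/2-suc m = sym (trans (/-+-/ (+ 2 ^ m) (+ 2 ^ m) 1)
                          (cong (λ k → + (2 ^ m +ℕ k) / 2) (sym (ℕ.+-identityʳ (2 ^ m)))))

size-generation : ∀ m → sumBy (const 1ℚ) (generation (suc m)) ≡ pow2/2 m + pow2/2 m
size-generation zero    = refl
size-generation (suc m) = begin
  sumBy (const 1ℚ) (generation (suc (suc m)))                ≡⟨ sumBy-concatMap-pair (const 1ℚ) leftChild rightChild G ⟩
  sumBy (λ _ → 1ℚ + 1ℚ) G                                    ≡⟨ sumBy-+ (const 1ℚ) (const 1ℚ) G ⟩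
  sumBy (const 1ℚ) G + sumBy (const 1ℚ) G                    ≡⟨ cong₂ _+_ (size-generation m) (size-generation m) ⟩
  (pow2/2 m + pow2/2 m) + (pow2/2 m + pow2/2 m)              ≡⟨ sym (cong₂ _+_ (pow2/2-suc m) (pow2/2-suc m)) ⟩
  pow2/2 (suc m) + pow2/2 (suc m)                            ∎
  where
  open ≡-Reasoning
  G : List Label
  G = generation (suc m)

sumBy-leftChild-generation : ∀ m → sumBy (value ∘ leftChild) (generation (suc m)) ≡ pow2/2 m
sumBy-leftChild-generation m = +-double-injective _ _ (begin
  sumBy (value ∘ leftChild) G + sumBy (value ∘ leftChild) G
    ≡⟨ cong (_+_ (sumBy (value ∘ leftChild) G)) (sym (sumBy-swap-generation m (value ∘ leftChild))) ⟩
  sumBy (value ∘ leftChild) G + sumBy (value ∘ leftChild ∘ swap) G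
    ≡⟨ sym (sumBy-+ (value ∘ leftChild) (value ∘ leftChild ∘ swap) G) ⟩
  sumBy (λ x → value (leftChild x) + value (leftChild (swap x))) G
    ≡⟨ sumBy-cong value-leftChild-+-swap G ⟩
  sumBy (const 1ℚ) G
    ≡⟨ size-generation m ⟩
  pow2/2 m + pow2/2 m ∎)
  where
  open ≡-Reasoning
  G : List Label
  G = generation (suc m)

sumBy-rightChild-generation : ∀ m →
  sumBy (value ∘ rightChild) (generation (suc m)) ≡ Σgen (suc m) + (pow2/2 m + pow2/2 m)
sumBy-rightChild-generation m = begin
  sumBy (value ∘ rightChild) G                ≡⟨ sumBy-cong value-rightChild G ⟩
  sumBy (λ x → value x + 1ℚ) G                ≡⟨ sumBy-+ value (const 1ℚ) G ⟩
  Σgen (suc m) + sumBy (const 1ℚ) G           ≡⟨ cong (_+_ (Σgen (suc m))) (size-generation m) ⟩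
  Σgen (suc m) + (pow2/2 m + pow2/2 m)        ∎
  where
  open ≡-Reasoning
  G : List Label
  G = generation (suc m)

Σgen-suc : ∀ m → Σgen (suc (suc m)) ≡ pow2/2 m + (Σgen (suc m) + (pow2/2 m + pow2/2 m))
Σgen-suc m = begin
  Σgen (suc (suc m))                                          ≡⟨ sumBy-concatMap-pair value leftChild rightChild G ⟩
  sumBy (λ x → value (leftChild x) + value (rightChild x)) G  ≡⟨ sumBy-+ (value ∘ leftChild) (value ∘ rightChild) G ⟩
  sumBy (value ∘ leftChild) G + sumBy (value ∘ rightChild) G  ≡⟨ cong₂ _+_ (sumBy-leftChild-generation m)
                                                                          (sumBy-rightChild-generation m) ⟩
  pow2/2 m + (Σgen (suc m) + (pow2/2 m + pow2/2 m))           ∎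
  where
  open ≡-Reasoning
  G : List Label
  G = generation (suc m)

theorem1 : (m : ℕ) → Σgen (suc m) ≡ (+ 3 / 1) * (+ (2 ^ m) / 2) - ½
theorem1 zero    = refl
theorem1 (suc m) = begin
  Σgen (suc (suc m))                                    ≡⟨ Σgen-suc m ⟩
  h + (Σgen (suc m) + (h + h))                          ≡⟨ cong (λ s → h + (s + (h + h))) (theorem1 m) ⟩
  h + ((+ 3 / 1) * h - ½ + (h + h))                     ≡⟨ telescope h ⟩
  (+ 3 / 1) * (h + h) - ½                               ≡⟨ cong (λ s → (+ 3 / 1) * s - ½) (sym (pow2/2-suc m)) ⟩
  (+ 3 / 1) * pow2/2 (suc m) - ½                        ∎
  where
  open ≡-Reasoning
  open ℚ-Solver.+-*-Solver
  h : ℚ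
  h = pow2/2 m
  telescope : ∀ r → r + ((+ 3 / 1) * r - ½ + (r + r)) ≡ (+ 3 / 1) * (r + r) - ½
  telescope = solve 1 (λ r → r :+ (con (+ 3 / 1) :* r :- con ½ :+ (r :+ r)) := con (+ 3 / 1) :* (r :+ r) :- con ½) refl
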